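{- Let $A$ be a finite alphabet with $|A|\ge 2$. For every language $L\subseteq A^*$: 1. $m^+(L)=\infty$ if and only if $m^-(L)=\infty$; 2. if $m^+(L)<\infty$ then $|m^+(L)-m^-(L)|=1$; 3. $m^+(L)=m^-(\overline{L})$, where $\overline{L}=A^*\setminus L$.
   Context: Subword relation: $w\sqsubseteq v$ iff there are $n\geq 0$, $a_1,\dots,a_n\in A$, $v_0,\dots,v_n\in A^*$ with $w=a_1\cdots a_n$ and $v=v_0a_1v_1\cdots a_nv_n$. For $m\geq 0$, write $w\to^m_L v$ iff there exist $w_0,\dots,w_m\in A^*$ with $w=w_0\sqsubseteq w_1\sqsubseteq\cdots\sqsubseteq w_m\sqsubseteq v$ and ($w_i\in L\iff w_{i+1}\notin L$) for $0\leq i\leq m-1$. $L^+(m)=\{v:\exists w\in L,\ w\to^m_L v\}$, $L^-(m)=\{v:\exists w\notin L,\ w\to^m_L v\}$. $m^+(L)=\max\{m\geq 0: L^+(m)\neq\emptyset\}$ and $m^-(L)=\max\{m\geq0: L^-(m)\neq\emptyset\}$, where the maximum is $\infty$ if the set is unbounded and is $-1$ if the set is empty. -}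

module Defs where

open import Data.Nat using (ℕ; zero; suc; _≤_)
open import Data.Integer using (ℤ; +_; -[1+_])
open import Data.List using (List)
open import Data.Product using (Σ; ∃; _×_)
open import Data.Sum using (_⊎_)
open import Relation.Nullary using (¬_)
open import Relation.Binary.PropositionalEquality using (_≡_)
open import Function.Bundles using (_⇔_)
import Data.List.Relation.Binary.Sublist.Propositional as Sub

Language : Set → Set₁
Language A = List A → Set

compl : {A : Set} → Language A → Language A
compl L w = ¬ L w

_⊑_ : {A : Set} → List A → List A → Set
w ⊑ v = w Sub.⊆ v

-- Alt L m w v : there are w = w₀ ⊑ w₁ ⊑ ⋯ ⊑ wₘ ⊑ v with
-- (wᵢ ∈ L ⇔ wᵢ₊₁ ∉ L) for 0 ≤ i ≤ m-1.  This is w →ᵐ_L v.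
data Alt {A : Set} (L : Language A) : ℕ → List A → List A → Set where
  done : ∀ {w v} → w ⊑ v → Alt L zero w v
  step : ∀ {m w u v} → w ⊑ u → (L w ⇔ (¬ L u)) → Alt L m u v → Alt L (suc m) w v

Lplus : {A : Set} → Language A → ℕ → List A → Set
Lplus L m v = ∃ λ w → L w × Alt L m w v

Lminus : {A : Set} → Language A → ℕ → List A → Set
Lminus L m v = ∃ λ w → (¬ L w) × Alt L m w v

-- Extended values: an integer (≥ -1 in practice) or ∞.
data ℤ∞ : Set where
  fin : ℤ → ℤ∞
  ∞   : ℤ∞

-- IsMax P x : "max { m ≥ 0 : P m } = x", with max = ∞ when unbounded
-- and max = -1 when the set is empty.
IsMax : (ℕ → Set) → ℤ∞ → Set
IsMax P ∞       = ∀ m → ∃ λ k → m ≤ k × P k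
IsMax P (fin z) =
  (z ≡ -[1+ 0 ] × (∀ m → ¬ P m))
  ⊎ (∃ λ k → z ≡ + k × P k × (∀ m → P m → m ≤ k))

IsMPlus : {A : Set} → Language A → ℤ∞ → Set
IsMPlus L = IsMax (λ m → ∃ λ v → Lplus L m v)

IsMMinus : {A : Set} → Language A → ℤ∞ → Set
IsMMinus L = IsMax (λ m → ∃ λ v → Lminus L m v)

{-# OPTIONS --safe #-}
-- Dropping the first word of an alternating chain witnessing L⁺(m+1) ≠ ∅
-- leaves a chain witnessing L⁻(m) ≠ ∅ (and symmetrically), while the empty
-- word, being a subword of everything, can be prepended to any chain that
-- starts on the other side of L from ε. So if ε ∈ L then L⁺(0) ≠ ∅ and
-- L⁺(m+1) ≠ ∅ ⇔ L⁻(m) ≠ ∅, whence m⁺(L) = m⁻(L) + 1; if ε ∉ L then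
-- m⁻(L) = m⁺(L) + 1 in the same way. The alternation condition
-- (wᵢ ∈ L ⇔ wᵢ₊₁ ∉ L) is invariant under complementing L, which exchanges
-- the roles of L⁺ and L⁻.
module Submission where

open import Defs
open import Data.Nat using (ℕ; _≤_; zero; suc; z≤n; s≤s)
open import Data.Nat.Properties using (≤-antisym; ≤-trans; n≤1+n; <⇒≱)
open import Data.Fin using (Fin)
open import Data.Integer using (ℤ; _-_; ∣_∣; +_; -_; 1ℤ)
  renaming (_+_ to _+ℤ_; suc to sucℤ)
open import Data.Integer.Properties using (+-assoc; +-inverseʳ; ∣i-j∣≡∣j-i∣)
open import Data.Product using (∃; _×_; _,_; map₂)
open import Data.Sum using (inj₁; inj₂)
open import Data.List using ([])
open import Data.List.Relation.Binary.Sublist.Heterogeneous using (minimum)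
open import Relation.Nullary using (¬_; yes; no; contradiction)
open import Relation.Nullary.Decidable using (decidable-stable)
open import Relation.Binary.PropositionalEquality using (_≡_; refl; cong; module ≡-Reasoning)
open import Function using (_∘′_)
open import Function.Bundles using (_⇔_; _↔_; mk⇔; Equivalence)
open import Function.Properties.Equivalence using () renaming (sym to ⇔-sym)
open import Axiom.ExcludedMiddle using (ExcludedMiddle)
open import Level using (0ℓ)

open Equivalence using (to; from)

suc∞ : ℤ∞ → ℤ∞
suc∞ (fin z) = fin (sucℤ z)
suc∞ ∞       = ∞

∣suc[i]-i∣≡1 : ∀ i → ∣ sucℤ i - i ∣ ≡ 1
∣suc[i]-i∣≡1 i = cong ∣_∣ (begin
  1ℤ +ℤ i - i      ≡⟨ +-assoc 1ℤ i (- i) ⟩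
  1ℤ +ℤ (i - i)    ≡⟨ cong (1ℤ +ℤ_) (+-inverseʳ i) ⟩
  1ℤ               ∎)
  where open ≡-Reasoning

∣i-suc[i]∣≡1 : ∀ i → ∣ i - sucℤ i ∣ ≡ 1
∣i-suc[i]∣≡1 i rewrite ∣i-j∣≡∣j-i∣ i (sucℤ i) = ∣suc[i]-i∣≡1 i

fin≡suc∞⇒adjacent : ∀ {z x} → fin z ≡ suc∞ x → ∃ λ z′ → x ≡ fin z′ × ∣ z - z′ ∣ ≡ 1
fin≡suc∞⇒adjacent {x = fin z′} refl = z′ , refl , ∣suc[i]-i∣≡1 z′

module _ {P Q : ℕ → Set} where

  IsMax-cong : (∀ m → P m ⇔ Q m) → ∀ {x} → IsMax P x → IsMax Q x
  IsMax-cong P⇔Q {∞} unbounded m = map₂ (map₂ (to (P⇔Q _))) (unbounded m)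
  IsMax-cong P⇔Q {fin _} (inj₁ (refl , empty)) = inj₁ (refl , λ m → empty m ∘′ from (P⇔Q m))
  IsMax-cong P⇔Q {fin _} (inj₂ (k , refl , Pk , max)) =
    inj₂ (k , refl , to (P⇔Q k) Pk , λ m Qm → max m (from (P⇔Q m) Qm))

  IsMax-∞-pred : (∀ m → P (suc m) → Q m) → IsMax P ∞ → IsMax Q ∞
  IsMax-∞-pred P⇒Q unbounded m with unbounded (suc m)
  ... | suc k , s≤s m≤k , Pk = k , m≤k , P⇒Q k Pk

  IsMax-suc∞ : P zero → (∀ m → P (suc m) ⇔ Q m) → ∀ {x} → IsMax Q x → IsMax P (suc∞ x)
  IsMax-suc∞ P0 P⇔Q {∞} unbounded m with unbounded m
  ... | k , m≤k , Qk = suc k , ≤-trans m≤k (n≤1+n k) , from (P⇔Q k) Qk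
  IsMax-suc∞ P0 P⇔Q {fin _} (inj₁ (refl , empty)) = inj₂ (zero , refl , P0 , max)
    where
    max : ∀ m → P m → m ≤ zero
    max zero    _  = z≤n
    max (suc m) Pm = contradiction (to (P⇔Q m) Pm) (empty m)
  IsMax-suc∞ P0 P⇔Q {fin _} (inj₂ (k , refl , Qk , maxQ)) = inj₂ (suc k , refl , from (P⇔Q k) Qk , max)
    where
    max : ∀ m → P m → m ≤ suc k
    max zero    _  = z≤n
    max (suc m) Pm = s≤s (maxQ m (to (P⇔Q m) Pm))

module _ {P : ℕ → Set} where

  IsMax-fin⇒bounded : ∀ {z} → IsMax P (fin z) → ¬ IsMax P ∞
  IsMax-fin⇒bounded (inj₁ (_ , empty)) unbounded with unbounded zero
  ... | k , _ , Pk = empty k Pk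
  IsMax-fin⇒bounded (inj₂ (k , _ , _ , max)) unbounded with unbounded (suc k)
  ... | j , k<j , Pj = <⇒≱ k<j (max j Pj)

  IsMax-unique : ∀ {x y} → IsMax P x → IsMax P y → x ≡ y
  IsMax-unique {∞}     {∞}     _ _ = refl
  IsMax-unique {∞}     {fin _} unbounded bounded = contradiction unbounded (IsMax-fin⇒bounded bounded)
  IsMax-unique {fin _} {∞}     bounded unbounded = contradiction unbounded (IsMax-fin⇒bounded bounded)
  IsMax-unique {fin _} {fin _} (inj₁ (refl , _)) (inj₁ (refl , _)) = refl
  IsMax-unique {fin _} {fin _} (inj₁ (_ , empty)) (inj₂ (k , _ , Pk , _)) = contradiction Pk (empty k)
  IsMax-unique {fin _} {fin _} (inj₂ (k , _ , Pk , _)) (inj₁ (_ , empty)) = contradiction Pk (empty k)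
  IsMax-unique {fin _} {fin _} (inj₂ (k , refl , Pk , maxk)) (inj₂ (j , refl , Pj , maxj)) =
    cong (fin ∘′ +_) (≤-antisym (maxj k Pk) (maxk j Pj))

module _ {A : Set} {L : Language A} where

  Lplus-suc⇒Lminus : ∀ {m v} → Lplus L (suc m) v → Lminus L m v
  Lplus-suc⇒Lminus (_ , w∈L , step _ alternates chain) = _ , to alternates w∈L , chain

  Lminus-suc⇒Lplus : ExcludedMiddle 0ℓ → ∀ {m v} → Lminus L (suc m) v → Lplus L m v
  Lminus-suc⇒Lplus em (_ , w∉L , step _ alternates chain) =
    _ , decidable-stable em (w∉L ∘′ from alternates) , chain

  Lminus⇒Lplus-suc : L [] → ∀ {m v} → Lminus L m v → Lplus L (suc m) v
  Lminus⇒Lplus-suc ε∈L (w , w∉L , chain) =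
    [] , ε∈L , step (minimum w) (mk⇔ (λ _ → w∉L) (λ _ → ε∈L)) chain

  Lplus⇒Lminus-suc : ¬ L [] → ∀ {m v} → Lplus L m v → Lminus L (suc m) v
  Lplus⇒Lminus-suc ε∉L (w , w∈L , chain) =
    [] , ε∉L , step (minimum w) alternates chain
    where
    alternates : L [] ⇔ (¬ L w)
    alternates = mk⇔ (λ ε∈L → contradiction ε∈L ε∉L) (λ w∉L → contradiction w∈L w∉L)

  IsMMinus⇒IsMPlus-suc∞ : L [] → ∀ {x} → IsMMinus L x → IsMPlus L (suc∞ x)
  IsMMinus⇒IsMPlus-suc∞ ε∈L = IsMax-suc∞ ([] , [] , ε∈L , done (minimum []))
    (λ _ → mk⇔ (map₂ Lplus-suc⇒Lminus) (map₂ (Lminus⇒Lplus-suc ε∈L)))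

  IsMPlus⇒IsMMinus-suc∞ : ExcludedMiddle 0ℓ → ¬ L [] → ∀ {x} → IsMPlus L x → IsMMinus L (suc∞ x)
  IsMPlus⇒IsMMinus-suc∞ em ε∉L = IsMax-suc∞ ([] , [] , ε∉L , done (minimum []))
    (λ _ → mk⇔ (map₂ (Lminus-suc⇒Lplus em)) (map₂ (Lplus⇒Lminus-suc ε∉L)))

module _ {P Q : Set} where

  ⇔¬⇒¬⇔¬¬ : (P ⇔ (¬ Q)) → ((¬ P) ⇔ (¬ ¬ Q))
  ⇔¬⇒¬⇔¬¬ P⇔¬Q = mk⇔ (λ ¬p ¬q → ¬p (from P⇔¬Q ¬q)) (λ ¬¬q p → ¬¬q (to P⇔¬Q p))

  ¬⇔¬¬⇒⇔¬ : ExcludedMiddle 0ℓ → ((¬ P) ⇔ (¬ ¬ Q)) → (P ⇔ (¬ Q))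
  ¬⇔¬¬⇒⇔¬ em ¬P⇔¬¬Q = mk⇔ (λ p q → from ¬P⇔¬¬Q (λ ¬q → ¬q q) p)
                          (λ ¬q → decidable-stable em (λ ¬p → to ¬P⇔¬¬Q ¬p ¬q))

module _ {A : Set} where

  Alt-map : {L L′ : Language A} → (∀ {w u} → (L w ⇔ (¬ L u)) → (L′ w ⇔ (¬ L′ u))) →
            ∀ {m w v} → Alt L m w v → Alt L′ m w v
  Alt-map f (done w⊑v)                  = done w⊑v
  Alt-map f (step w⊑u alternates chain) = step w⊑u (f alternates) (Alt-map f chain)

  Lplus⇔Lminus-compl : ExcludedMiddle 0ℓ → ∀ {L : Language A} {m v} →
                       Lplus L m v ⇔ Lminus (compl L) m v
  Lplus⇔Lminus-compl em = mk⇔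
    (λ (w , w∈L , chain) → w , (λ w∉L → w∉L w∈L) , Alt-map ⇔¬⇒¬⇔¬¬ chain)
    (λ (w , w∉compl , chain) → w , decidable-stable em w∉compl , Alt-map (¬⇔¬¬⇒⇔¬ em) chain)

module _ (em : ExcludedMiddle 0ℓ) {A : Set} {L : Language A} where

  m⁺∞⇔m⁻∞ : IsMPlus L ∞ ⇔ IsMMinus L ∞
  m⁺∞⇔m⁻∞ = mk⇔ (IsMax-∞-pred (λ _ → map₂ Lplus-suc⇒Lminus))
                (IsMax-∞-pred (λ _ → map₂ (Lminus-suc⇒Lplus em)))

  m⁺-m⁻-adjacent : ∀ z x → IsMPlus L (fin z) → IsMMinus L x → ∃ λ z′ → x ≡ fin z′ × ∣ z - z′ ∣ ≡ 1
  m⁺-m⁻-adjacent z x m⁺ m⁻ with em {L []}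
  ... | yes ε∈L = fin≡suc∞⇒adjacent (IsMax-unique m⁺ (IsMMinus⇒IsMPlus-suc∞ ε∈L m⁻))
  ... | no  ε∉L = sucℤ z , IsMax-unique m⁻ (IsMPlus⇒IsMMinus-suc∞ em ε∉L m⁺) , ∣i-suc[i]∣≡1 z

  m⁺⇔m⁻-compl : ∀ x → IsMPlus L x ⇔ IsMMinus (compl L) x
  m⁺⇔m⁻-compl _ = mk⇔ (IsMax-cong (λ m → plus⇔minus-compl {m}))
                      (IsMax-cong (λ m → ⇔-sym (plus⇔minus-compl {m})))
    where
    plus⇔minus-compl : ∀ {m} → (∃ λ v → Lplus L m v) ⇔ (∃ λ v → Lminus (compl L) m v)
    plus⇔minus-compl = mk⇔ (map₂ (to (Lplus⇔Lminus-compl em))) (map₂ (from (Lplus⇔Lminus-compl em)))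

proposition3p8 : ExcludedMiddle 0ℓ →
    (A : Set) (n : ℕ) → A ↔ Fin n → 2 ≤ n →
    (L : Language A) →
      (IsMPlus L ∞ ⇔ IsMMinus L ∞)
      × (∀ (z : ℤ) (x : ℤ∞) → IsMPlus L (fin z) → IsMMinus L x →
           ∃ λ z′ → x ≡ fin z′ × ∣ z - z′ ∣ ≡ 1)
      × (∀ (x : ℤ∞) → IsMPlus L x ⇔ IsMMinus (compl L) x)
proposition3p8 em _ _ _ _ L = m⁺∞⇔m⁻∞ em , m⁺-m⁻-adjacent em , m⁺⇔m⁻-compl em
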